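{- Let $\alpha,\beta,\gamma,x\in\mathbb{N}_0$ with $(\alpha,\beta,\gamma,x)\neq(0,0,0,0)$ and let $\lambda\in\mathbb{N}_0$. Then for every integer $n\ge0$, $$A^{\lambda,x}_{n+1}(\alpha,\beta,\gamma)=\gamma\, A^{\lambda,x}_n(\alpha,\beta,\gamma+\alpha)+x\lambda\beta\sum_{k=0}^{n}\binom{n}{k}A^{1,x}_{k}(\alpha,\beta,\gamma+\beta+\alpha)\,A^{\lambda,x}_{n-k}(\alpha,\beta,0).$$
   Context: For a number $\alpha$ and integer $n\ge0$, $(t|\alpha)_n=t(t-\alpha)\cdots(t-(n-1)\alpha)$, $(t|\alpha)_0=1$. For numbers $\alpha,\beta,\gamma$ the generalised Stirling numbers $S(n,k,\alpha,\beta,\gamma)$, $0\le k\le n$, are defined by the polynomial identity $(t|\alpha)_n=\sum_{k=0}^{n}S(n,k,\alpha,\beta,\gamma)(t-\gamma|\beta)_k$. For a number $\lambda$ and integer $k\ge0$, $\binom{k+\lambda-1}{k}=\lambda(\lambda+1)\cdots(\lambda+k-1)/k!$ (equal to $1$ for $k=0$). Define $$A^{\lambda,x}_n(\alpha,\beta,\gamma)=\sum_{k=0}^{n}\binom{k+\lambda-1}{k}(-1)^{n+k}\beta^k k!\,S(n,k,\alpha,-\beta,-\gamma)\,x^k.$$ -}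

module Defs where

open import Data.Nat as ℕ using (ℕ; zero; suc; _!; _/_; _≤_)
open import Data.Nat.Properties using (_!≢0)
open import Data.Nat.Combinatorics using (_C_)
open import Data.Integer as ℤ using (ℤ; +_; _+_; _-_; _*_; -_; _^_)
open import Relation.Binary.PropositionalEquality using (_≡_)

sumTo : ℕ → (ℕ → ℤ) → ℤ
sumTo zero    f = f zero
sumTo (suc n) f = sumTo n f + f (suc n)

gfall : ℤ → ℤ → ℕ → ℤ
gfall t α zero    = + 1
gfall t α (suc n) = gfall t α n * (t - (+ n) * α)

-- Generalised Stirling number family: a function S n k α β γ satisfying the
-- defining polynomial identity (t|α)_n = Σ_{k=0}^n S(n,k,α,β,γ) (t-γ|β)_k
-- (as an identity of polynomials in t, i.e. for every integer t).
StirlingFamily : Set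
StirlingFamily = ℕ → ℕ → ℤ → ℤ → ℤ → ℤ

IsGenStirling : StirlingFamily → Set
IsGenStirling S =
  ∀ (α β γ : ℤ) (n : ℕ) (t : ℤ) →
    gfall t α n ≡ sumTo n (λ k → S n k α β γ * gfall (t - γ) β k)

-- binom(k+λ-1, k) = λ(λ+1)⋯(λ+k-1)/k!
rising : ℕ → ℕ → ℕ
rising l zero    = 1
rising l (suc k) = rising l k ℕ.* (l ℕ.+ k)

multiBinom : ℕ → ℕ → ℕ
multiBinom l k = (rising l k / k !) {{k !≢0}}

sgn : ℕ → ℤ
sgn m = (- + 1) ^ m

A : StirlingFamily → (l x : ℕ) → (n : ℕ) → (α β γ : ℕ) → ℤ
A S l x n α β γ =
  sumTo n (λ k →
    (+ multiBinom l k) * sgn (n ℕ.+ k) * (+ β) ^ k * (+ (k !))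
      * S n k (+ α) (- (+ β)) (- (+ γ)) * (+ x) ^ k)

module Submission where

-- Write ρ_a(z,n) = z(z+a)⋯(z+(n-1)a) and E(g,n,k) = Δ^k_j ρ_a(g + j·b, n) at j = 0, where Δ is
-- the forward difference. The proof replaces every Stirling-weighted sum by such differences.
-- 1. Newton inversion (F(j) = Σ_m C(j,m) W(m) implies Δ^k F = W(k)), applied to the defining
--    identity of S at t = -(g + j·b) together with (-(j·b) | -b)_k = (-1)^k C(j,k) k! b^k, gives
--    (-1)^{n+k} b^k k! S(n,k,a,-b,-g) = E(g,n,k); so A^{λ,x}_n(α,β,γ) = Σ_k C(k+λ-1,k) x^k E(γ,n,k).
-- 2. ρ_a(z,n+1) = z·ρ_a(z+a,n) and the Leibniz rule for Δ against the linear factor g + j·b give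
--    E(g,n+1,k+1) = g·E(g+a,n,k+1) + (k+1)·b·E(g+a+b,n,k). With the absorption identity
--    (k+1)·C(k+λ,k+1) = λ·C(k+λ,k) this yields the first summand plus Σ_k C(k+λ,k) x^k E(g+a+b,n,k).
-- 3. Vandermonde's identity for ρ_a gives E(g₁+g₂,n,k₁+k₂) = Σ_m C(n,m) E(g₁,m,k₁) E(g₂,n-m,k₂);
--    with the hockey stick C(k+λ,k) = Σ_{j≤k} C(j+λ-1,j) the last sum becomes the binomial
--    convolution of A^{1,x} and A^{λ,x}.

open import Defs
open import Data.Nat as ℕ using (ℕ; zero; suc; _∸_; _!; _≤_; _<_; _≤′_; z≤n; s≤s)
import Data.Nat.Properties as ℕP
open ℕP using (_!≢0)
open import Data.Nat.DivMod using (m*n/n≡m)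
open import Data.Nat.Combinatorics using (_C_; k>n⇒nCk≡0; nC1≡n; nCk+nC[k+1]≡[n+1]C[k+1])
open import Data.Integer as ℤ using (ℤ; +_; _+_; _*_; _-_; -_; _^_)
import Data.Integer.Properties as ℤP
import Data.Nat.Tactic.RingSolver as ℕRing
open import Data.Integer.Tactic.RingSolver using (solve-∀)
open import Data.Product using (_×_)
open import Relation.Nullary using (¬_)
open import Relation.Binary.PropositionalEquality
open import Function using (_∘_)

sumTo-cong : ∀ n {f g : ℕ → ℤ} → (∀ k → k ≤ n → f k ≡ g k) → sumTo n f ≡ sumTo n g
sumTo-cong zero    f≡g = f≡g 0 z≤n
sumTo-cong (suc n) f≡g =
  cong₂ _+_ (sumTo-cong n (λ k k≤n → f≡g k (ℕP.m≤n⇒m≤1+n k≤n))) (f≡g (suc n) ℕP.≤-refl)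

sumTo-+ : ∀ n (f g : ℕ → ℤ) → sumTo n (λ k → f k + g k) ≡ sumTo n f + sumTo n g
sumTo-+ zero    f g = refl
sumTo-+ (suc n) f g =
  trans (cong (_+ (f (suc n) + g (suc n))) (sumTo-+ n f g))
        (interchange (sumTo n f) (sumTo n g) (f (suc n)) (g (suc n)))
  where interchange : ∀ (a b c d : ℤ) → a + b + (c + d) ≡ a + c + (b + d)
        interchange = solve-∀

sumTo-*ˡ : ∀ n (c : ℤ) (f : ℕ → ℤ) → sumTo n (λ k → c * f k) ≡ c * sumTo n f
sumTo-*ˡ zero    c f = refl
sumTo-*ˡ (suc n) c f =
  trans (cong (_+ (c * f (suc n))) (sumTo-*ˡ n c f)) (sym (ℤP.*-distribˡ-+ c (sumTo n f) (f (suc n))))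

sumTo-*ʳ : ∀ n (c : ℤ) (f : ℕ → ℤ) → sumTo n (λ k → f k * c) ≡ sumTo n f * c
sumTo-*ʳ zero    c f = refl
sumTo-*ʳ (suc n) c f =
  trans (cong (_+ (f (suc n) * c)) (sumTo-*ʳ n c f)) (sym (ℤP.*-distribʳ-+ c (sumTo n f) (f (suc n))))

sumTo-zeros : ∀ n (f : ℕ → ℤ) → (∀ k → f k ≡ + 0) → sumTo n f ≡ + 0
sumTo-zeros zero    f f≡0 = f≡0 0
sumTo-zeros (suc n) f f≡0 = cong₂ _+_ (sumTo-zeros n f f≡0) (f≡0 (suc n))

sumTo-shift : ∀ n (f : ℕ → ℤ) → sumTo (suc n) f ≡ f 0 + sumTo n (f ∘ suc)
sumTo-shift zero    f = refl
sumTo-shift (suc n) f =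
  trans (cong (_+ f (suc (suc n))) (sumTo-shift n f)) (ℤP.+-assoc (f 0) (sumTo n (f ∘ suc)) (f (suc (suc n))))

sumTo-extend : ∀ {m n} (f : ℕ → ℤ) → m ≤ n → (∀ k → m < k → f k ≡ + 0) → sumTo m f ≡ sumTo n f
sumTo-extend f m≤n = go (ℕP.≤⇒≤′ m≤n)
  where
    go : ∀ {m n} → m ≤′ n → (∀ k → m < k → f k ≡ + 0) → sumTo m f ≡ sumTo n f
    go ℕ.≤′-refl            vanish = refl
    go (ℕ.≤′-step {n} m≤′n) vanish =
      trans (go m≤′n vanish)
            (sym (trans (cong (_+_ (sumTo n f)) (vanish (suc n) (s≤s (ℕP.≤′⇒≤ m≤′n)))) (ℤP.+-identityʳ (sumTo n f))))

sumTo-swap : ∀ n m (f : ℕ → ℕ → ℤ) →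
  sumTo n (λ i → sumTo m (λ j → f i j)) ≡ sumTo m (λ j → sumTo n (λ i → f i j))
sumTo-swap zero    m f = refl
sumTo-swap (suc n) m f =
  trans (cong (_+ sumTo m (f (suc n))) (sumTo-swap n m f))
        (sym (sumTo-+ m (λ j → sumTo n (λ i → f i j)) (f (suc n))))

sumTo-product : ∀ n m (u v : ℕ → ℤ) →
  sumTo n u * sumTo m v ≡ sumTo n (λ i → sumTo m (λ j → u i * v j))
sumTo-product n m u v =
  trans (sym (sumTo-*ʳ n (sumTo m v) u)) (sumTo-cong n (λ i _ → sym (sumTo-*ˡ m (u i) v)))

sumTo-pascal : ∀ n (F : ℕ → ℕ → ℤ) →
  sumTo (suc n) (λ m → + (suc n C m) * F m (suc n ∸ m))
  ≡ sumTo n (λ m → + (n C m) * F (suc m) (n ∸ m)) + sumTo n (λ m → + (n C m) * F m (suc n ∸ m))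
sumTo-pascal n F =
  begin
    sumTo (suc n) (λ m → + (suc n C m) * F m (suc n ∸ m))
  ≡⟨ sumTo-shift n _ ⟩
    + 1 * F 0 (suc n) + sumTo n (λ m → + (suc n C suc m) * F (suc m) (n ∸ m))
  ≡⟨ cong (_+_ (+ 1 * F 0 (suc n))) (trans (sumTo-cong n (λ m _ → split m)) (sumTo-+ n L R)) ⟩
    + 1 * F 0 (suc n) + (sumTo n L + sumTo n R)
  ≡⟨ regroup (+ 1 * F 0 (suc n)) (sumTo n L) (sumTo n R) ⟩
    sumTo n L + (G 0 + sumTo n (G ∘ suc))
  ≡⟨ cong (_+_ (sumTo n L)) (sym (sumTo-shift n G)) ⟩
    sumTo n L + sumTo (suc n) G
  ≡⟨ cong (_+_ (sumTo n L)) (sym (sumTo-extend G (ℕP.n≤1+n n) G-vanish)) ⟩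
    sumTo n L + sumTo n G
  ∎
  where
    open ≡-Reasoning
    L R G : ℕ → ℤ
    L m = + (n C m) * F (suc m) (n ∸ m)
    R m = + (n C suc m) * F (suc m) (n ∸ m)
    G m = + (n C m) * F m (suc n ∸ m)
    split : ∀ m → + (suc n C suc m) * F (suc m) (n ∸ m) ≡ L m + R m
    split m = trans (cong (λ c → + c * F (suc m) (n ∸ m)) (sym (nCk+nC[k+1]≡[n+1]C[k+1] n m)))
                    (ℤP.*-distribʳ-+ (F (suc m) (n ∸ m)) (+ (n C m)) (+ (n C suc m)))
    G-vanish : ∀ k → n < k → G k ≡ + 0
    G-vanish k n<k = trans (cong (λ c → + c * F k (suc n ∸ k)) (k>n⇒nCk≡0 n<k)) (ℤP.*-zeroˡ (F k (suc n ∸ k)))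
    regroup : ∀ (x a b : ℤ) → x + (a + b) ≡ a + (x + b)
    regroup = solve-∀

sumTo-triangle : ∀ n (c F : ℕ → ℤ) →
  sumTo n (λ k → sumTo k c * F k) ≡ sumTo n (λ j → c j * sumTo (n ∸ j) (λ i → F (i ℕ.+ j)))
sumTo-triangle zero    c F = refl
sumTo-triangle (suc n) c F =
  begin
    sumTo n (λ k → sumTo k c * F k) + sumTo (suc n) c * F (suc n)
  ≡⟨ cong₂ _+_ (sumTo-triangle n c F) (sym (sumTo-*ʳ (suc n) (F (suc n)) c)) ⟩
    sumTo n T + (sumTo n (λ j → c j * F (suc n)) + c (suc n) * F (suc n))
  ≡⟨ sym (ℤP.+-assoc (sumTo n T) _ _) ⟩
    sumTo n T + sumTo n (λ j → c j * F (suc n)) + c (suc n) * F (suc n)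
  ≡⟨ cong (_+ c (suc n) * F (suc n)) (sym (sumTo-+ n _ _)) ⟩
    sumTo n (λ j → T j + c j * F (suc n)) + c (suc n) * F (suc n)
  ≡⟨ cong (_+ c (suc n) * F (suc n)) (sumTo-cong n row) ⟩
    sumTo n T′ + c (suc n) * F (suc n)
  ≡⟨ cong (λ d → sumTo n T′ + c (suc n) * sumTo d (λ i → F (i ℕ.+ suc n))) (sym (ℕP.n∸n≡0 n)) ⟩
    sumTo (suc n) T′
  ∎
  where
    open ≡-Reasoning
    T T′ : ℕ → ℤ
    T  j = c j * sumTo (n ∸ j) (λ i → F (i ℕ.+ j))
    T′ j = c j * sumTo (suc n ∸ j) (λ i → F (i ℕ.+ j))
    row : ∀ j → j ≤ n → T j + c j * F (suc n) ≡ T′ j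
    row j j≤n = trans (sym (ℤP.*-distribˡ-+ (c j) _ _))
      (cong (c j *_) (trans (cong (λ k → sumTo (n ∸ j) (λ i → F (i ℕ.+ j)) + F (suc k)) (sym (ℕP.m∸n+n≡m j≤n)))
                            (cong (λ d → sumTo d (λ i → F (i ℕ.+ j))) (sym (ℕP.+-∸-assoc 1 j≤n)))))

sumTo-diagonal : ∀ n (c F : ℕ → ℤ) → (∀ k → n < k → F k ≡ + 0) →
  sumTo n (λ k → sumTo k c * F k) ≡ sumTo n (λ j → c j * sumTo n (λ i → F (i ℕ.+ j)))
sumTo-diagonal n c F F-vanish =
  trans (sumTo-triangle n c F)
        (sumTo-cong n (λ j _ → cong (c j *_) (sumTo-extend _ (ℕP.m∸n≤m n j) (λ i p → F-vanish (i ℕ.+ j) (beyond i j p)))))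
  where
    beyond : ∀ i j → n ∸ j < i → n < i ℕ.+ j
    beyond i j p = ℕP.≤-<-trans (ℕP.m≤n+m∸n n j) (subst (j ℕ.+ (n ∸ j) <_) (ℕP.+-comm j i) (ℕP.+-monoʳ-< j p))

pascal : ∀ j k → + (suc j C suc k) ≡ + (j C k) + + (j C suc k)
pascal j k = trans (cong +_ (sym (nCk+nC[k+1]≡[n+1]C[k+1] j k))) (ℤP.pos-+ (j C k) (j C suc k))

binom-absorb : ∀ j k → suc k ℕ.* (suc j C suc k) ≡ suc j ℕ.* (j C k)
binom-absorb zero    zero    = refl
binom-absorb zero    (suc k) = ℕP.*-zeroʳ (suc (suc k))
binom-absorb (suc j) zero    = trans (ℕP.*-identityˡ _) (trans (nC1≡n (suc (suc j))) (sym (ℕP.*-identityʳ _)))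
binom-absorb (suc j) (suc k) =
  begin
    (2 ℕ.+ k) ℕ.* ((2 ℕ.+ j) C (2 ℕ.+ k))
  ≡⟨ cong ((2 ℕ.+ k) ℕ.*_) (sym (nCk+nC[k+1]≡[n+1]C[k+1] (suc j) (suc k))) ⟩
    (2 ℕ.+ k) ℕ.* (c₁ ℕ.+ c₂)
  ≡⟨ spread (suc k) c₁ c₂ ⟩
    c₁ ℕ.+ ((1 ℕ.+ k) ℕ.* c₁ ℕ.+ (2 ℕ.+ k) ℕ.* c₂)
  ≡⟨ cong₂ (λ u v → c₁ ℕ.+ (u ℕ.+ v)) (binom-absorb j k) (binom-absorb j (suc k)) ⟩
    c₁ ℕ.+ ((1 ℕ.+ j) ℕ.* (j C k) ℕ.+ (1 ℕ.+ j) ℕ.* (j C suc k))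
  ≡⟨ cong (c₁ ℕ.+_) (sym (ℕP.*-distribˡ-+ (1 ℕ.+ j) (j C k) (j C suc k))) ⟩
    c₁ ℕ.+ (1 ℕ.+ j) ℕ.* (j C k ℕ.+ j C suc k)
  ≡⟨ cong (λ c → c₁ ℕ.+ (1 ℕ.+ j) ℕ.* c) (nCk+nC[k+1]≡[n+1]C[k+1] j k) ⟩
    (2 ℕ.+ j) ℕ.* c₁
  ∎
  where
    open ≡-Reasoning
    c₁ c₂ : ℕ
    c₁ = suc j C suc k
    c₂ = suc j C suc (suc k)
    spread : ∀ k c₁ c₂ → (1 ℕ.+ k) ℕ.* (c₁ ℕ.+ c₂) ≡ c₁ ℕ.+ (k ℕ.* c₁ ℕ.+ (1 ℕ.+ k) ℕ.* c₂)
    spread = ℕRing.solve-∀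

-- Forward differences: Δ k f = (Δ^k f)(0).

Δ : ℕ → (ℕ → ℤ) → ℤ
Δ zero    f = f 0
Δ (suc k) f = Δ k (f ∘ suc) - Δ k f

Δ-cong : ∀ k {f g : ℕ → ℤ} → (∀ j → f j ≡ g j) → Δ k f ≡ Δ k g
Δ-cong zero    f≡g = f≡g 0
Δ-cong (suc k) f≡g = cong₂ _-_ (Δ-cong k (f≡g ∘ suc)) (Δ-cong k f≡g)

Δ-+ : ∀ k (f g : ℕ → ℤ) → Δ k (λ j → f j + g j) ≡ Δ k f + Δ k g
Δ-+ zero    f g = refl
Δ-+ (suc k) f g =
  trans (cong₂ _-_ (Δ-+ k (f ∘ suc) (g ∘ suc)) (Δ-+ k f g))
        (interchange (Δ k (f ∘ suc)) (Δ k (g ∘ suc)) (Δ k f) (Δ k g))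
  where interchange : ∀ (a b c d : ℤ) → a + b - (c + d) ≡ (a - c) + (b - d)
        interchange = solve-∀

Δ-*ˡ : ∀ k (c : ℤ) (f : ℕ → ℤ) → Δ k (λ j → c * f j) ≡ c * Δ k f
Δ-*ˡ zero    c f = refl
Δ-*ˡ (suc k) c f =
  trans (cong₂ _-_ (Δ-*ˡ k c (f ∘ suc)) (Δ-*ˡ k c f)) (factor c _ _)
  where factor : ∀ (c x y : ℤ) → c * x - c * y ≡ c * (x - y)
        factor = solve-∀

Δ-*ʳ : ∀ k (c : ℤ) (f : ℕ → ℤ) → Δ k (λ j → f j * c) ≡ Δ k f * c
Δ-*ʳ k c f = trans (Δ-cong k (λ j → ℤP.*-comm (f j) c)) (trans (Δ-*ˡ k c f) (ℤP.*-comm c (Δ k f)))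

Δ-sum : ∀ k n (f : ℕ → ℕ → ℤ) → Δ k (λ j → sumTo n (λ m → f m j)) ≡ sumTo n (λ m → Δ k (f m))
Δ-sum k zero    f = refl
Δ-sum k (suc n) f =
  trans (Δ-+ k (λ j → sumTo n (λ m → f m j)) (f (suc n))) (cong (_+ Δ k (f (suc n))) (Δ-sum k n f))

Δ-const : ∀ k (c : ℤ) → Δ (suc k) (λ _ → c) ≡ + 0
Δ-const k c = ℤP.+-inverseʳ (Δ k (λ _ → c))

Δ-iterate : ∀ k₁ k₂ (F : ℕ → ℤ) → Δ k₁ (λ i → Δ k₂ (λ j → F (i ℕ.+ j))) ≡ Δ (k₁ ℕ.+ k₂) F
Δ-iterate zero     k₂ F = refl
Δ-iterate (suc k₁) k₂ F = cong₂ _-_ (Δ-iterate k₁ k₂ (F ∘ suc)) (Δ-iterate k₁ k₂ F)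

δ : ℕ → ℕ → ℤ
δ zero    zero    = + 1
δ zero    (suc m) = + 0
δ (suc k) zero    = + 0
δ (suc k) (suc m) = δ k m

Δ-binom : ∀ k m → Δ k (λ j → + (j C m)) ≡ δ k m
Δ-binom zero    zero    = refl
Δ-binom zero    (suc m) = refl
Δ-binom (suc k) zero    = Δ-const k (+ 1)
Δ-binom (suc k) (suc m) =
  trans (cong (_- Δ k (λ j → + (j C suc m))) (trans (Δ-cong k (λ j → pascal j m)) (Δ-+ k _ _)))
        (trans (cancel (Δ k (λ j → + (j C m))) _) (Δ-binom k m))
  where cancel : ∀ (x y : ℤ) → x + y - y ≡ x
        cancel = solve-∀

δ-pick : ∀ {k N} (W : ℕ → ℤ) → k ≤ N → sumTo N (λ m → δ k m * W m) ≡ W k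
δ-pick {zero}  {zero}  W z≤n = ℤP.*-identityˡ (W 0)
δ-pick {zero}  {suc N} W z≤n =
  trans (sumTo-shift N _)
        (trans (cong₂ _+_ (ℤP.*-identityˡ (W 0)) (sumTo-zeros N _ (λ m → ℤP.*-zeroˡ (W (suc m)))))
               (ℤP.+-identityʳ (W 0)))
δ-pick {suc k} {suc N} W (s≤s k≤N) =
  trans (sumTo-shift N _)
        (trans (cong₂ _+_ (ℤP.*-zeroˡ (W 0)) (δ-pick (W ∘ suc) k≤N)) (ℤP.+-identityˡ (W (suc k))))

newton-inversion : ∀ N (W F : ℕ → ℤ) → (∀ j → F j ≡ sumTo N (λ m → + (j C m) * W m)) →
  ∀ k → k ≤ N → Δ k F ≡ W k
newton-inversion N W F F≡ k k≤N =
  begin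
    Δ k F
  ≡⟨ Δ-cong k F≡ ⟩
    Δ k (λ j → sumTo N (λ m → + (j C m) * W m))
  ≡⟨ Δ-sum k N (λ m j → + (j C m) * W m) ⟩
    sumTo N (λ m → Δ k (λ j → + (j C m) * W m))
  ≡⟨ sumTo-cong N (λ m _ → trans (Δ-*ʳ k (W m) _) (cong (_* W m) (Δ-binom k m))) ⟩
    sumTo N (λ m → δ k m * W m)
  ≡⟨ δ-pick W k≤N ⟩
    W k
  ∎
  where open ≡-Reasoning

module _ (b : ℤ) where

  linear-suc : ∀ (c : ℤ) j → c + + suc j * b ≡ (c + b) + + j * b
  linear-suc c j = trans (cong (λ z → c + z * b) (ℤP.pos-+ 1 j)) (expand c b (+ j))
    where expand : ∀ (c b x : ℤ) → c + (+ 1 + x) * b ≡ (c + b) + x * b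
          expand = solve-∀

  Δ-linear-zero : ∀ (c : ℤ) (h : ℕ → ℤ) → Δ 0 (λ j → (c + + j * b) * h j) ≡ c * h 0
  Δ-linear-zero c h = drop c b (h 0)
    where drop : ∀ (c b x : ℤ) → (c + + 0 * b) * x ≡ c * x
          drop = solve-∀

  Δ-linear-suc : ∀ k (c : ℤ) (h : ℕ → ℤ) →
    Δ (suc k) (λ j → (c + + j * b) * h j) ≡ c * Δ (suc k) h + + suc k * b * Δ k (h ∘ suc)
  Δ-linear-suc zero c h = expand c b (h 0) (h 1)
    where expand : ∀ (c b x y : ℤ) → (c + + 1 * b) * y - (c + + 0 * b) * x ≡ c * (y - x) + + 1 * b * y
          expand = solve-∀
  Δ-linear-suc (suc k) c h =
    trans (cong₂ _-_ (trans (Δ-cong (suc k) (λ j → cong (_* h (suc j)) (linear-suc c j)))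
                            (Δ-linear-suc k (c + b) (h ∘ suc)))
                     (Δ-linear-suc k c h))
          (trans (collect c b (Δ (suc k) h) (Δ k (h ∘ suc ∘ suc)) (Δ k (h ∘ suc)) (+ suc k))
                 (cong (λ z → c * Δ (suc (suc k)) h + z * b * Δ (suc k) (h ∘ suc)) (sym (ℤP.pos-+ 1 (suc k)))))
    where collect : ∀ (c b Y P Q K : ℤ) →
                      (c + b) * (P - Q) + K * b * P - (c * Y + K * b * Q)
                      ≡ c * ((P - Q) - Y) + (+ 1 + K) * b * (P - Q)
          collect = solve-∀

module _ (a : ℤ) where

  rise : ℤ → ℕ → ℤ
  rise z zero    = + 1
  rise z (suc n) = rise z n * (z + + n * a)

  rise-suc : ∀ n z → rise z (suc n) ≡ z * rise (z + a) n
  rise-suc zero    z = unit z a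
    where unit : ∀ (z a : ℤ) → + 1 * (z + + 0 * a) ≡ z * + 1
          unit = solve-∀
  rise-suc (suc n) z =
    trans (cong (_* (z + + suc n * a)) (rise-suc n z))
      (trans (cong (λ w → z * rise (z + a) n * (z + w * a)) (ℤP.pos-+ 1 n))
             (reassoc z a (rise (z + a) n) (+ n)))
    where reassoc : ∀ (z a r x : ℤ) → z * r * (z + (+ 1 + x) * a) ≡ z * (r * ((z + a) + x * a))
          reassoc = solve-∀

  gfall-neg : ∀ n z → gfall (- z) a n ≡ sgn n * rise z n
  gfall-neg zero    z = refl
  gfall-neg (suc n) z =
    trans (cong (_* (- z - + n * a)) (gfall-neg n z)) (pull-sign (sgn n) (rise z n) z (+ n * a))
    where pull-sign : ∀ (s r z w : ℤ) → s * r * (- z - w) ≡ (- + 1) * s * (r * (z + w))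
          pull-sign = solve-∀

  rise-vandermonde : ∀ n z₁ z₂ →
    rise (z₁ + z₂) n ≡ sumTo n (λ m → + (n C m) * (rise z₁ m * rise z₂ (n ∸ m)))
  rise-vandermonde zero    z₁ z₂ = refl
  rise-vandermonde (suc n) z₁ z₂ =
    begin
      rise (z₁ + z₂) (suc n)
    ≡⟨ rise-suc n (z₁ + z₂) ⟩
      (z₁ + z₂) * rise (z₁ + z₂ + a) n
    ≡⟨ ℤP.*-distribʳ-+ (rise (z₁ + z₂ + a) n) z₁ z₂ ⟩
      z₁ * rise (z₁ + z₂ + a) n + z₂ * rise (z₁ + z₂ + a) n
    ≡⟨ cong₂ (λ u v → z₁ * rise u n + z₂ * rise v n) (swap-a z₁ z₂ a) (ℤP.+-assoc z₁ z₂ a) ⟩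
      z₁ * rise ((z₁ + a) + z₂) n + z₂ * rise (z₁ + (z₂ + a)) n
    ≡⟨ cong₂ (λ u v → z₁ * u + z₂ * v) (rise-vandermonde n (z₁ + a) z₂) (rise-vandermonde n z₁ (z₂ + a)) ⟩
      z₁ * sumTo n (λ m → + (n C m) * (rise (z₁ + a) m * rise z₂ (n ∸ m)))
        + z₂ * sumTo n (λ m → + (n C m) * (rise z₁ m * rise (z₂ + a) (n ∸ m)))
    ≡⟨ cong₂ _+_ (sym (sumTo-*ˡ n z₁ _)) (sym (sumTo-*ˡ n z₂ _)) ⟩
      sumTo n (λ m → z₁ * (+ (n C m) * (rise (z₁ + a) m * rise z₂ (n ∸ m))))
        + sumTo n (λ m → z₂ * (+ (n C m) * (rise z₁ m * rise (z₂ + a) (n ∸ m))))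
    ≡⟨ cong₂ _+_ (sumTo-cong n (λ m _ → absorb-left m)) (sumTo-cong n absorb-right) ⟩
      sumTo n (λ m → + (n C m) * (rise z₁ (suc m) * rise z₂ (n ∸ m)))
        + sumTo n (λ m → + (n C m) * (rise z₁ m * rise z₂ (suc n ∸ m)))
    ≡⟨ sym (sumTo-pascal n (λ m r → rise z₁ m * rise z₂ r)) ⟩
      sumTo (suc n) (λ m → + (suc n C m) * (rise z₁ m * rise z₂ (suc n ∸ m)))
    ∎
    where
      open ≡-Reasoning
      swap-a : ∀ (x y a : ℤ) → x + y + a ≡ (x + a) + y
      swap-a = solve-∀
      move-left : ∀ (z c r s : ℤ) → z * (c * (r * s)) ≡ c * ((z * r) * s)
      move-left = solve-∀
      move-right : ∀ (z c r s : ℤ) → z * (c * (r * s)) ≡ c * (r * (z * s))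
      move-right = solve-∀
      absorb-left : ∀ m → z₁ * (+ (n C m) * (rise (z₁ + a) m * rise z₂ (n ∸ m)))
                          ≡ + (n C m) * (rise z₁ (suc m) * rise z₂ (n ∸ m))
      absorb-left m = trans (move-left z₁ (+ (n C m)) (rise (z₁ + a) m) (rise z₂ (n ∸ m)))
                            (cong (λ w → + (n C m) * (w * rise z₂ (n ∸ m))) (sym (rise-suc m z₁)))
      absorb-right : ∀ m → m ≤ n → z₂ * (+ (n C m) * (rise z₁ m * rise (z₂ + a) (n ∸ m)))
                                   ≡ + (n C m) * (rise z₁ m * rise z₂ (suc n ∸ m))
      absorb-right m m≤n = trans (move-right z₂ (+ (n C m)) (rise z₁ m) (rise (z₂ + a) (n ∸ m)))
        (cong (λ w → + (n C m) * (rise z₁ m * w))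
              (trans (sym (rise-suc (n ∸ m) z₂)) (cong (rise z₂) (sym (ℕP.+-∸-assoc 1 m≤n)))))

gfall-suc : ∀ (t α : ℤ) k → gfall t α (suc k) ≡ t * gfall (t - α) α k
gfall-suc t α zero    = unit t α
  where unit : ∀ (t α : ℤ) → + 1 * (t - + 0 * α) ≡ t * + 1
        unit = solve-∀
gfall-suc t α (suc k) =
  trans (cong (_* (t - + suc k * α)) (gfall-suc t α k))
    (trans (cong (λ w → t * gfall (t - α) α k * (t - w * α)) (ℤP.pos-+ 1 k))
           (reassoc t α (gfall (t - α) α k) (+ k)))
  where reassoc : ∀ (t α g x : ℤ) → t * g * (t - (+ 1 + x) * α) ≡ t * (g * ((t - α) - x * α))
        reassoc = solve-∀

gfall-multiple : ∀ (b : ℤ) j k → gfall (- (+ j * b)) (- b) k ≡ sgn k * (+ (j C k) * (+ (k !) * b ^ k))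
gfall-multiple b j       zero    = refl
gfall-multiple b zero    (suc k) =
  trans (gfall-suc (- (+ 0 * b)) (- b) k) (zero-factor b (gfall (- (+ 0 * b) - - b) (- b) k) (sgn (suc k)) (+ (suc k !) * b ^ suc k))
  where zero-factor : ∀ (b g s y : ℤ) → - (+ 0 * b) * g ≡ s * (+ 0 * y)
        zero-factor = solve-∀
gfall-multiple b (suc j) (suc k) =
  begin
    gfall (- (J₁ * b)) (- b) (suc k)
  ≡⟨ gfall-suc (- (J₁ * b)) (- b) k ⟩
    - (J₁ * b) * gfall (- (J₁ * b) - - b) (- b) k
  ≡⟨ cong (λ t → - (J₁ * b) * gfall t (- b) k) step-back ⟩
    - (J₁ * b) * gfall (- (+ j * b)) (- b) k
  ≡⟨ cong (- (J₁ * b) *_) (gfall-multiple b j k) ⟩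
    - (J₁ * b) * (sgn k * (+ (j C k) * (+ (k !) * b ^ k)))
  ≡⟨ collect J₁ b (sgn k) (+ (j C k)) (+ (k !)) (b ^ k) ⟩
    sgn (suc k) * ((J₁ * + (j C k)) * (+ (k !) * b ^ suc k))
  ≡⟨ cong (λ c → sgn (suc k) * (c * (+ (k !) * b ^ suc k)))
          (trans (sym (ℤP.pos-* (suc j) (j C k))) (cong +_ (sym (binom-absorb j k)))) ⟩
    sgn (suc k) * (+ (suc k ℕ.* (suc j C suc k)) * (+ (k !) * b ^ suc k))
  ≡⟨ cong (λ c → sgn (suc k) * (c * (+ (k !) * b ^ suc k))) (ℤP.pos-* (suc k) (suc j C suc k)) ⟩
    sgn (suc k) * ((+ suc k * + (suc j C suc k)) * (+ (k !) * b ^ suc k))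
  ≡⟨ cong (sgn (suc k) *_) (regroup (+ suc k) (+ (suc j C suc k)) (+ (k !)) (b ^ suc k)) ⟩
    sgn (suc k) * (+ (suc j C suc k) * ((+ suc k * + (k !)) * b ^ suc k))
  ≡⟨ cong (λ f → sgn (suc k) * (+ (suc j C suc k) * (f * b ^ suc k))) (sym (ℤP.pos-* (suc k) (k !))) ⟩
    sgn (suc k) * (+ (suc j C suc k) * (+ (suc k !) * b ^ suc k))
  ∎
  where
    open ≡-Reasoning
    J₁ : ℤ
    J₁ = + suc j
    step-back : - (J₁ * b) - - b ≡ - (+ j * b)
    step-back = trans (cong (λ w → - (w * b) - - b) (ℤP.pos-+ 1 j)) (cancel (+ j) b)
      where cancel : ∀ (x b : ℤ) → - ((+ 1 + x) * b) - - b ≡ - (x * b)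
            cancel = solve-∀
    collect : ∀ (J b s c f B : ℤ) → - (J * b) * (s * (c * (f * B))) ≡ ((- + 1) * s) * ((J * c) * (f * (b * B)))
    collect = solve-∀
    regroup : ∀ (K c f B : ℤ) → (K * c) * (f * B) ≡ c * ((K * f) * B)
    regroup = solve-∀

module _ (a b : ℤ) where

  diffRise : ℤ → ℕ → ℕ → ℤ
  diffRise g n k = Δ k (λ j → rise a (g + + j * b) n)

  private
    diffRise-suc-n : ∀ g n k → diffRise g (suc n) k ≡ Δ k (λ j → (g + + j * b) * rise a (g + a + + j * b) n)
    diffRise-suc-n g n k = Δ-cong k (λ j → trans (rise-suc a n (g + + j * b))
                              (cong (λ w → (g + + j * b) * rise a w n) (swap g (+ j * b) a)))
      where swap : ∀ (g x a : ℤ) → g + x + a ≡ g + a + x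
            swap = solve-∀

  diffRise-zero : ∀ g n → diffRise g (suc n) 0 ≡ g * diffRise (g + a) n 0
  diffRise-zero g n = trans (diffRise-suc-n g n 0) (Δ-linear-zero b g (λ j → rise a (g + a + + j * b) n))

  diffRise-suc : ∀ g n k →
    diffRise g (suc n) (suc k) ≡ g * diffRise (g + a) n (suc k) + + suc k * b * diffRise (g + a + b) n k
  diffRise-suc g n k = trans (diffRise-suc-n g n (suc k))
    (trans (Δ-linear-suc b k g (λ j → rise a (g + a + + j * b) n))
      (cong (λ w → g * diffRise (g + a) n (suc k) + + suc k * b * w)
        (Δ-cong k (λ j → cong (λ w → rise a w n) (linear-suc b (g + a) j)))))

  -- ρ_a(g + j·b, n) has degree n in j, so its differences of order > n vanish.
  diffRise-vanish : ∀ n k g → n < k → diffRise g n k ≡ + 0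
  diffRise-vanish zero    (suc k) g _         = Δ-const k (+ 1)
  diffRise-vanish (suc n) (suc k) g (s≤s n<k) =
    trans (diffRise-suc g n k)
      (trans (cong₂ (λ u v → g * u + + suc k * b * v)
                    (diffRise-vanish n (suc k) (g + a) (ℕP.m≤n⇒m≤1+n n<k))
                    (diffRise-vanish n k (g + a + b) n<k))
             (zeros g (+ suc k * b)))
    where zeros : ∀ (g c : ℤ) → g * + 0 + c * + 0 ≡ + 0
          zeros = solve-∀

  -- Vandermonde's convolution, transported to differences.
  diffRise-convolution : ∀ n k₁ k₂ g₁ g₂ →
    diffRise (g₁ + g₂) n (k₁ ℕ.+ k₂) ≡ sumTo n (λ m → + (n C m) * (diffRise g₁ m k₁ * diffRise g₂ (n ∸ m) k₂))
  diffRise-convolution n k₁ k₂ g₁ g₂ =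
    begin
      diffRise (g₁ + g₂) n (k₁ ℕ.+ k₂)
    ≡⟨ sym (Δ-iterate k₁ k₂ _) ⟩
      Δ k₁ (λ i → Δ k₂ (λ j → rise a (g₁ + g₂ + + (i ℕ.+ j) * b) n))
    ≡⟨ Δ-cong k₁ (λ i → Δ-cong k₂ (λ j → trans (cong (λ w → rise a w n) (split-argument i j))
                   (rise-vandermonde a n (g₁ + + i * b) (g₂ + + j * b)))) ⟩
      Δ k₁ (λ i → Δ k₂ (λ j → sumTo n (λ m → + (n C m) * (P i m * Q j m))))
    ≡⟨ Δ-cong k₁ (λ i → trans (Δ-sum k₂ n (λ m j → + (n C m) * (P i m * Q j m)))
                              (sumTo-cong n (λ m _ → inner i m))) ⟩
      Δ k₁ (λ i → sumTo n (λ m → (+ (n C m) * P i m) * diffRise g₂ (n ∸ m) k₂))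
    ≡⟨ Δ-sum k₁ n (λ m i → (+ (n C m) * P i m) * diffRise g₂ (n ∸ m) k₂) ⟩
      sumTo n (λ m → Δ k₁ (λ i → (+ (n C m) * P i m) * diffRise g₂ (n ∸ m) k₂))
    ≡⟨ sumTo-cong n (λ m _ → outer m) ⟩
      sumTo n (λ m → + (n C m) * (diffRise g₁ m k₁ * diffRise g₂ (n ∸ m) k₂))
    ∎
    where
      open ≡-Reasoning
      P : ℕ → ℕ → ℤ
      P i m = rise a (g₁ + + i * b) m
      Q : ℕ → ℕ → ℤ
      Q j m = rise a (g₂ + + j * b) (n ∸ m)
      split-argument : ∀ i j → g₁ + g₂ + + (i ℕ.+ j) * b ≡ (g₁ + + i * b) + (g₂ + + j * b)
      split-argument i j = trans (cong (λ w → g₁ + g₂ + w * b) (ℤP.pos-+ i j)) (distribute g₁ g₂ (+ i) (+ j) b)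
        where distribute : ∀ (g₁ g₂ i j b : ℤ) → g₁ + g₂ + (i + j) * b ≡ (g₁ + i * b) + (g₂ + j * b)
              distribute = solve-∀
      inner : ∀ i m → Δ k₂ (λ j → + (n C m) * (P i m * Q j m)) ≡ (+ (n C m) * P i m) * diffRise g₂ (n ∸ m) k₂
      inner i m = trans (Δ-cong k₂ (λ j → sym (ℤP.*-assoc (+ (n C m)) (P i m) (Q j m))))
                        (Δ-*ˡ k₂ (+ (n C m) * P i m) (λ j → Q j m))
      outer : ∀ m → Δ k₁ (λ i → (+ (n C m) * P i m) * diffRise g₂ (n ∸ m) k₂)
                    ≡ + (n C m) * (diffRise g₁ m k₁ * diffRise g₂ (n ∸ m) k₂)
      outer m = trans (Δ-*ʳ k₁ (diffRise g₂ (n ∸ m) k₂) (λ i → + (n C m) * P i m))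
                  (trans (cong (_* diffRise g₂ (n ∸ m) k₂) (Δ-*ˡ k₁ (+ (n C m)) (λ i → P i m)))
                         (ℤP.*-assoc (+ (n C m)) (diffRise g₁ m k₁) (diffRise g₂ (n ∸ m) k₂)))

sgn-square : ∀ n → sgn n * sgn n ≡ + 1
sgn-square zero    = refl
sgn-square (suc n) = trans (cancel-signs (sgn n)) (sgn-square n)
  where cancel-signs : ∀ (s : ℤ) → (- + 1) * s * ((- + 1) * s) ≡ s * s
        cancel-signs = solve-∀

stirling-as-difference : (S : StirlingFamily) → IsGenStirling S → ∀ (a b g : ℤ) n k → k ≤ n →
  sgn (n ℕ.+ k) * b ^ k * + (k !) * S n k a (- b) (- g) ≡ diffRise a b g n k
stirling-as-difference S isS a b g n k k≤n = sym (newton-inversion n W F expansion k k≤n)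
  where
    open ≡-Reasoning
    W : ℕ → ℤ
    W i = sgn (n ℕ.+ i) * b ^ i * + (i !) * S n i a (- b) (- g)
    F : ℕ → ℤ
    F j = rise a (g + + j * b) n
    shift-back : ∀ (g x : ℤ) → - (g + x) - - g ≡ - x
    shift-back = solve-∀
    double-sign : ∀ (s R : ℤ) → s * s ≡ + 1 → R ≡ s * (s * R)
    double-sign s R s²≡1 = trans (sym (ℤP.*-identityˡ R)) (trans (cong (_* R) (sym s²≡1)) (ℤP.*-assoc s s R))
    regroup : ∀ (sn sk Sk c f B : ℤ) → sn * (Sk * (sk * (c * (f * B)))) ≡ c * (sn * sk * B * f * Sk)
    regroup = solve-∀
    -- ρ_a(g + j·b, n) = (-1)^n (-(g + j·b) | a)_n, expanded in the basis (-(j·b) | -b)_k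
    expansion : ∀ j → F j ≡ sumTo n (λ k → + (j C k) * W k)
    expansion j =
      begin
        F j
      ≡⟨ double-sign (sgn n) (F j) (sgn-square n) ⟩
        sgn n * (sgn n * F j)
      ≡⟨ cong (sgn n *_) (sym (gfall-neg a n (g + + j * b))) ⟩
        sgn n * gfall (- (g + + j * b)) a n
      ≡⟨ cong (sgn n *_) (isS a (- b) (- g) n (- (g + + j * b))) ⟩
        sgn n * sumTo n (λ k → S n k a (- b) (- g) * gfall (- (g + + j * b) - - g) (- b) k)
      ≡⟨ cong (sgn n *_) (sumTo-cong n (λ k _ → cong (S n k a (- b) (- g) *_)
            (trans (cong (λ t → gfall t (- b) k) (shift-back g (+ j * b))) (gfall-multiple b j k)))) ⟩
        sgn n * sumTo n (λ k → S n k a (- b) (- g) * (sgn k * (+ (j C k) * (+ (k !) * b ^ k))))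
      ≡⟨ sym (sumTo-*ˡ n (sgn n) _) ⟩
        sumTo n (λ k → sgn n * (S n k a (- b) (- g) * (sgn k * (+ (j C k) * (+ (k !) * b ^ k)))))
      ≡⟨ sumTo-cong n (λ k _ → trans (regroup (sgn n) (sgn k) (S n k a (- b) (- g)) (+ (j C k)) (+ (k !)) (b ^ k))
            (cong (λ s → + (j C k) * (s * b ^ k * + (k !) * S n k a (- b) (- g)))
                  (sym (ℤP.^-distribˡ-+-* (- + 1) n k)))) ⟩
        sumTo n (λ k → + (j C k) * W k)
      ∎

-- Multiset coefficients multichoose l k = C(k+l-1,k), defined by Pascal's rule; they agree
-- with multiBinom l k = λ(λ+1)⋯(λ+k-1)/k!, and this definition makes their identities inductive.

multichoose : ℕ → ℕ → ℕ
multichoose l       zero    = 1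
multichoose zero    (suc k) = 0
multichoose (suc l) (suc k) = multichoose (suc l) k ℕ.+ multichoose l (suc k)

rising-suc : ∀ l k → rising l (suc k) ≡ l ℕ.* rising (suc l) k
rising-suc l zero    = unit l
  where unit : ∀ l → 1 ℕ.* (l ℕ.+ 0) ≡ l ℕ.* 1
        unit = ℕRing.solve-∀
rising-suc l (suc k) = trans (cong (ℕ._* (l ℕ.+ suc k)) (rising-suc l k)) (reassoc l (rising (suc l) k) k)
  where reassoc : ∀ l r k → l ℕ.* r ℕ.* (l ℕ.+ (1 ℕ.+ k)) ≡ l ℕ.* (r ℕ.* (1 ℕ.+ l ℕ.+ k))
        reassoc = ℕRing.solve-∀

rising≡multichoose*! : ∀ l k → rising l k ≡ multichoose l k ℕ.* k !
rising≡multichoose*! l       zero    = refl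
rising≡multichoose*! zero    (suc k) = rising-suc 0 k
rising≡multichoose*! (suc l) (suc k) =
  begin
    rising (suc l) k ℕ.* (suc l ℕ.+ k)
  ≡⟨ cong (ℕ._* (suc l ℕ.+ k)) (rising≡multichoose*! (suc l) k) ⟩
    M ℕ.* k ! ℕ.* (suc l ℕ.+ k)
  ≡⟨ spread M (k !) l k ⟩
    M ℕ.* suc k ! ℕ.+ l ℕ.* (M ℕ.* k !)
  ≡⟨ cong (λ r → M ℕ.* suc k ! ℕ.+ l ℕ.* r) (sym (rising≡multichoose*! (suc l) k)) ⟩
    M ℕ.* suc k ! ℕ.+ l ℕ.* rising (suc l) k
  ≡⟨ cong (M ℕ.* suc k ! ℕ.+_) (trans (sym (rising-suc l k)) (rising≡multichoose*! l (suc k))) ⟩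
    M ℕ.* suc k ! ℕ.+ multichoose l (suc k) ℕ.* suc k !
  ≡⟨ sym (ℕP.*-distribʳ-+ (suc k !) M (multichoose l (suc k))) ⟩
    multichoose (suc l) (suc k) ℕ.* suc k !
  ∎
  where
    open ≡-Reasoning
    M : ℕ
    M = multichoose (suc l) k
    spread : ∀ M F l k → M ℕ.* F ℕ.* (1 ℕ.+ l ℕ.+ k) ≡ M ℕ.* ((1 ℕ.+ k) ℕ.* F) ℕ.+ l ℕ.* (M ℕ.* F)
    spread = ℕRing.solve-∀

multiBinom≡multichoose : ∀ l k → multiBinom l k ≡ multichoose l k
multiBinom≡multichoose l k =
  trans (cong (λ r → (r ℕ./ k !) {{k !≢0}}) (rising≡multichoose*! l k)) (m*n/n≡m (multichoose l k) (k !) {{k !≢0}})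

multichoose-absorb : ∀ l k → multichoose l (suc k) ℕ.* suc k ≡ l ℕ.* multichoose (suc l) k
multichoose-absorb l k = ℕP.*-cancelʳ-≡ _ _ (k !) {{k !≢0}}
  (begin
    multichoose l (suc k) ℕ.* suc k ℕ.* k !
  ≡⟨ ℕP.*-assoc (multichoose l (suc k)) (suc k) (k !) ⟩
    multichoose l (suc k) ℕ.* suc k !
  ≡⟨ sym (rising≡multichoose*! l (suc k)) ⟩
    rising l (suc k)
  ≡⟨ rising-suc l k ⟩
    l ℕ.* rising (suc l) k
  ≡⟨ cong (l ℕ.*_) (rising≡multichoose*! (suc l) k) ⟩
    l ℕ.* (multichoose (suc l) k ℕ.* k !)
  ≡⟨ sym (ℕP.*-assoc l (multichoose (suc l) k) (k !)) ⟩
    l ℕ.* multichoose (suc l) k ℕ.* k !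
  ∎)
  where open ≡-Reasoning

-- C(k,k) = 1, so A^{1,x} carries no coefficients.
multichoose-one : ∀ k → multichoose 1 k ≡ 1
multichoose-one zero    = refl
multichoose-one (suc k) = cong (ℕ._+ 0) (multichoose-one k)

multichoose-hockey : ∀ l k → + multichoose (suc l) k ≡ sumTo k (λ j → + multichoose l j)
multichoose-hockey l zero    = refl
multichoose-hockey l (suc k) =
  trans (ℤP.pos-+ (multichoose (suc l) k) (multichoose l (suc k)))
        (cong (_+ + multichoose l (suc k)) (multichoose-hockey l k))

module _ (a b X : ℤ) where

  Aterm : ℕ → ℕ → ℤ → ℕ → ℤ
  Aterm l n g k = + multichoose l k * X ^ k * diffRise a b g n k

  Adiff : ℕ → ℕ → ℤ → ℤ
  Adiff l n g = sumTo n (Aterm l n g)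

  Aterm-vanish : ∀ l n g k → n < k → Aterm l n g k ≡ + 0
  Aterm-vanish l n g k n<k =
    trans (cong (+ multichoose l k * X ^ k *_) (diffRise-vanish a b n k g n<k)) (ℤP.*-zeroʳ (+ multichoose l k * X ^ k))

  Adiff-extend : ∀ l {m n} g → m ≤ n → Adiff l m g ≡ sumTo n (Aterm l m g)
  Adiff-extend l {m} g m≤n = sumTo-extend (Aterm l m g) m≤n (Aterm-vanish l m g)

  -- Termwise form of the recurrence, using the absorption identity for the coefficients.
  Aterm-suc : ∀ l n g k →
    Aterm l (suc n) g (suc k) ≡ g * Aterm l n (g + a) (suc k) + X * + l * b * Aterm (suc l) n (g + a + b) k
  Aterm-suc l n g k =
    begin
      + M * X ^ suc k * diffRise a b g (suc n) (suc k)
    ≡⟨ cong (+ M * X ^ suc k *_) (diffRise-suc a b g n k) ⟩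
      + M * X ^ suc k * (g * E₁ + + suc k * b * E₂)
    ≡⟨ distribute (+ M) X (X ^ k) g E₁ (+ suc k) b E₂ ⟩
      g * Aterm l n (g + a) (suc k) + (+ M * + suc k) * (X * b * X ^ k * E₂)
    ≡⟨ cong (λ c → g * Aterm l n (g + a) (suc k) + c * (X * b * X ^ k * E₂)) absorb ⟩
      g * Aterm l n (g + a) (suc k) + (+ l * + M′) * (X * b * X ^ k * E₂)
    ≡⟨ cong (_+_ (g * Aterm l n (g + a) (suc k))) (regroup (+ l) (+ M′) X b (X ^ k) E₂) ⟩
      g * Aterm l n (g + a) (suc k) + X * + l * b * Aterm (suc l) n (g + a + b) k
    ∎
    where
      open ≡-Reasoning
      M M′ : ℕ
      M  = multichoose l (suc k)
      M′ = multichoose (suc l) k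
      E₁ E₂ : ℤ
      E₁ = diffRise a b (g + a) n (suc k)
      E₂ = diffRise a b (g + a + b) n k
      absorb : + M * + suc k ≡ + l * + M′
      absorb = trans (sym (ℤP.pos-* M (suc k))) (trans (cong +_ (multichoose-absorb l k)) (ℤP.pos-* l M′))
      distribute : ∀ (M X Xk g E₁ K b E₂ : ℤ) →
        M * (X * Xk) * (g * E₁ + K * b * E₂) ≡ g * (M * (X * Xk) * E₁) + (M * K) * (X * b * Xk * E₂)
      distribute = solve-∀
      regroup : ∀ (L M′ X b Xk E₂ : ℤ) → (L * M′) * (X * b * Xk * E₂) ≡ X * L * b * (M′ * Xk * E₂)
      regroup = solve-∀

  Adiff-recurrence : ∀ l n g →
    Adiff l (suc n) g ≡ g * Adiff l n (g + a) + X * + l * b * sumTo n (Aterm (suc l) n (g + a + b))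
  Adiff-recurrence l n g =
    begin
      sumTo (suc n) (Aterm l (suc n) g)
    ≡⟨ sumTo-shift n _ ⟩
      Aterm l (suc n) g 0 + sumTo n (Aterm l (suc n) g ∘ suc)
    ≡⟨ cong₂ _+_ head (trans (sumTo-cong n (λ k _ → Aterm-suc l n g k)) (sumTo-+ n _ _)) ⟩
      g * T₀ + (sumTo n (λ k → g * T₁ k) + sumTo n (λ k → c * T₂ k))
    ≡⟨ cong₂ (λ u v → g * T₀ + (u + v)) (sumTo-*ˡ n g T₁) (sumTo-*ˡ n c T₂) ⟩
      g * T₀ + (g * sumTo n T₁ + c * sumTo n T₂)
    ≡⟨ factor g T₀ (sumTo n T₁) (c * sumTo n T₂) ⟩
      g * (T₀ + sumTo n T₁) + c * sumTo n T₂
    ≡⟨ cong (λ s → g * s + c * sumTo n T₂) (sym (sumTo-shift n (Aterm l n (g + a)))) ⟩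
      g * sumTo (suc n) (Aterm l n (g + a)) + c * sumTo n T₂
    ≡⟨ cong (λ s → g * s + c * sumTo n T₂) (sym (Adiff-extend l (g + a) (ℕP.n≤1+n n))) ⟩
      g * Adiff l n (g + a) + c * sumTo n T₂
    ∎
    where
      open ≡-Reasoning
      c T₀ : ℤ
      c  = X * + l * b
      T₀ = Aterm l n (g + a) 0
      T₁ T₂ : ℕ → ℤ
      T₁ k = Aterm l n (g + a) (suc k)
      T₂ k = Aterm (suc l) n (g + a + b) k
      head : Aterm l (suc n) g 0 ≡ g * T₀
      head = trans (cong (+ 1 * + 1 *_) (diffRise-zero a b g n)) (commute g (diffRise a b (g + a) n 0))
        where commute : ∀ (g E : ℤ) → + 1 * + 1 * (g * E) ≡ g * (+ 1 * + 1 * E)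
              commute = solve-∀
      factor : ∀ (g t s r : ℤ) → g * t + (g * s + r) ≡ g * (t + s) + r
      factor = solve-∀

  convolution-coefficient : ∀ l n g i j →
    sumTo n (λ m → (+ (n C m) * Aterm 1 m g i) * Aterm l (n ∸ m) (+ 0) j)
    ≡ + multichoose l j * (X ^ (i ℕ.+ j) * diffRise a b g n (i ℕ.+ j))
  convolution-coefficient l n g i j =
    begin
      sumTo n (λ m → (+ (n C m) * Aterm 1 m g i) * Aterm l (n ∸ m) (+ 0) j)
    ≡⟨ sumTo-cong n (λ m _ → trans (cong (λ o → (+ (n C m) * (+ o * X ^ i * E m)) * Aterm l (n ∸ m) (+ 0) j)
                                         (multichoose-one i))
                                   (regroup (+ (n C m)) (X ^ i) (X ^ j) c (E m) (E′ m))) ⟩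
      sumTo n (λ m → (c * (X ^ i * X ^ j)) * (+ (n C m) * (E m * E′ m)))
    ≡⟨ sumTo-*ˡ n (c * (X ^ i * X ^ j)) _ ⟩
      (c * (X ^ i * X ^ j)) * sumTo n (λ m → + (n C m) * (E m * E′ m))
    ≡⟨ cong ((c * (X ^ i * X ^ j)) *_) (sym (diffRise-convolution a b n i j g (+ 0))) ⟩
      (c * (X ^ i * X ^ j)) * diffRise a b (g + + 0) n (i ℕ.+ j)
    ≡⟨ cong₂ (λ w h → (c * w) * diffRise a b h n (i ℕ.+ j)) (sym (ℤP.^-distribˡ-+-* X i j)) (ℤP.+-identityʳ g) ⟩
      (c * X ^ (i ℕ.+ j)) * diffRise a b g n (i ℕ.+ j)
    ≡⟨ ℤP.*-assoc c (X ^ (i ℕ.+ j)) (diffRise a b g n (i ℕ.+ j)) ⟩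
      c * (X ^ (i ℕ.+ j) * diffRise a b g n (i ℕ.+ j))
    ∎
    where
      open ≡-Reasoning
      c : ℤ
      c = + multichoose l j
      E E′ : ℕ → ℤ
      E  m = diffRise a b g m i
      E′ m = diffRise a b (+ 0) (n ∸ m) j
      regroup : ∀ (C Xi Xj c E E′ : ℤ) → (C * (+ 1 * Xi * E)) * (c * Xj * E′) ≡ (c * (Xi * Xj)) * (C * (E * E′))
      regroup = solve-∀

  Adiff-product : ∀ l n g →
    sumTo n (λ m → + (n C m) * Adiff 1 m g * Adiff l (n ∸ m) (+ 0))
    ≡ sumTo n (λ j → + multichoose l j * sumTo n (λ i → X ^ (i ℕ.+ j) * diffRise a b g n (i ℕ.+ j)))
  Adiff-product l n g =
    begin
      sumTo n (λ m → + (n C m) * Adiff 1 m g * Adiff l (n ∸ m) (+ 0))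
    ≡⟨ sumTo-cong n expand ⟩
      sumTo n (λ m → sumTo n (λ i → sumTo n (λ j → t m i j)))
    ≡⟨ trans (sumTo-swap n n _) (sumTo-cong n (λ i _ → sumTo-swap n n _)) ⟩
      sumTo n (λ i → sumTo n (λ j → sumTo n (λ m → t m i j)))
    ≡⟨ sumTo-cong n (λ i _ → sumTo-cong n (λ j _ → convolution-coefficient l n g i j)) ⟩
      sumTo n (λ i → sumTo n (λ j → + multichoose l j * F (i ℕ.+ j)))
    ≡⟨ sumTo-swap n n _ ⟩
      sumTo n (λ j → sumTo n (λ i → + multichoose l j * F (i ℕ.+ j)))
    ≡⟨ sumTo-cong n (λ j _ → sumTo-*ˡ n (+ multichoose l j) (λ i → F (i ℕ.+ j))) ⟩
      sumTo n (λ j → + multichoose l j * sumTo n (λ i → F (i ℕ.+ j)))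
    ∎
    where
      open ≡-Reasoning
      F : ℕ → ℤ
      F k = X ^ k * diffRise a b g n k
      t : ℕ → ℕ → ℕ → ℤ
      t m i j = (+ (n C m) * Aterm 1 m g i) * Aterm l (n ∸ m) (+ 0) j
      expand : ∀ m → m ≤ n → + (n C m) * Adiff 1 m g * Adiff l (n ∸ m) (+ 0) ≡ sumTo n (λ i → sumTo n (λ j → t m i j))
      expand m m≤n =
        trans (cong₂ (λ s r → + (n C m) * s * r) (Adiff-extend 1 g m≤n) (Adiff-extend l (+ 0) (ℕP.m∸n≤m n m)))
          (trans (cong (_* sumTo n (Aterm l (n ∸ m) (+ 0))) (sym (sumTo-*ˡ n (+ (n C m)) (Aterm 1 m g))))
                 (sumTo-product n n _ _))

  Adiff-convolution : ∀ l n g →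
    sumTo n (Aterm (suc l) n g) ≡ sumTo n (λ m → + (n C m) * Adiff 1 m g * Adiff l (n ∸ m) (+ 0))
  Adiff-convolution l n g =
    begin
      sumTo n (Aterm (suc l) n g)
    ≡⟨ sumTo-cong n (λ k _ → trans (ℤP.*-assoc (+ multichoose (suc l) k) (X ^ k) (diffRise a b g n k))
                                   (cong (_* F k) (multichoose-hockey l k))) ⟩
      sumTo n (λ k → sumTo k (λ j → + multichoose l j) * F k)
    ≡⟨ sumTo-diagonal n (λ j → + multichoose l j) F F-vanish ⟩
      sumTo n (λ j → + multichoose l j * sumTo n (λ i → F (i ℕ.+ j)))
    ≡⟨ sym (Adiff-product l n g) ⟩
      sumTo n (λ m → + (n C m) * Adiff 1 m g * Adiff l (n ∸ m) (+ 0))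
    ∎
    where
      open ≡-Reasoning
      F : ℕ → ℤ
      F k = X ^ k * diffRise a b g n k
      F-vanish : ∀ k → n < k → F k ≡ + 0
      F-vanish k n<k = trans (cong (X ^ k *_) (diffRise-vanish a b n k g n<k)) (ℤP.*-zeroʳ (X ^ k))

A≡Adiff : (S : StirlingFamily) → IsGenStirling S → ∀ (l x n α β γ : ℕ) →
  A S l x n α β γ ≡ Adiff (+ α) (+ β) (+ x) l n (+ γ)
A≡Adiff S isS l x n α β γ = sumTo-cong n (λ k k≤n →
  begin
    + multiBinom l k * s k * B k * + (k !) * Sk k * X k
  ≡⟨ cong (λ c → + c * s k * B k * + (k !) * Sk k * X k) (multiBinom≡multichoose l k) ⟩
    + multichoose l k * s k * B k * + (k !) * Sk k * X k
  ≡⟨ regroup (+ multichoose l k) (s k) (B k) (+ (k !)) (Sk k) (X k) ⟩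
    + multichoose l k * X k * (s k * B k * + (k !) * Sk k)
  ≡⟨ cong (+ multichoose l k * X k *_) (stirling-as-difference S isS (+ α) (+ β) (+ γ) n k k≤n) ⟩
    Aterm (+ α) (+ β) (+ x) l n (+ γ) k
  ∎)
  where
    open ≡-Reasoning
    s B Sk X : ℕ → ℤ
    s  k = sgn (n ℕ.+ k)
    B  k = (+ β) ^ k
    Sk k = S n k (+ α) (- (+ β)) (- (+ γ))
    X  k = (+ x) ^ k
    regroup : ∀ (M s B f S X : ℤ) → M * s * B * f * S * X ≡ M * X * (s * B * f * S)
    regroup = solve-∀

mainTheorem3 : (S : StirlingFamily) → IsGenStirling S →
    (α β γ x l : ℕ) →
    ¬ (α ≡ 0 × β ≡ 0 × γ ≡ 0 × x ≡ 0) →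
    (n : ℕ) →
      A S l x (ℕ.suc n) α β γ
        ≡ (+ γ) * A S l x n α β (γ ℕ.+ α)
          + (+ x) * (+ l) * (+ β)
            * sumTo n (λ k → (+ (n C k)) * A S 1 x k α β (γ ℕ.+ β ℕ.+ α)
                                         * A S l x (n ∸ k) α β 0)
mainTheorem3 S isS α β γ x l _ n =
  begin
    A S l x (suc n) α β γ
  ≡⟨ A≡Adiff S isS l x (suc n) α β γ ⟩
    Adiff a b X l (suc n) g
  ≡⟨ Adiff-recurrence a b X l n g ⟩
    g * Adiff a b X l n (g + a) + X * + l * b * sumTo n (Aterm a b X (suc l) n (g + a + b))
  ≡⟨ cong (λ s → g * Adiff a b X l n (g + a) + X * + l * b * s) (Adiff-convolution a b X l n (g + a + b)) ⟩
    g * Adiff a b X l n (g + a)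
      + X * + l * b * sumTo n (λ k → + (n C k) * Adiff a b X 1 k (g + a + b) * Adiff a b X l (n ∸ k) (+ 0))
  ≡⟨ sym (cong₂ (λ u v → g * u + X * + l * b * v) (A≡Adiff S isS l x n α β (γ ℕ.+ α))
                                                 (sumTo-cong n (λ k _ → convolution-term k))) ⟩
    + γ * A S l x n α β (γ ℕ.+ α)
      + X * + l * b * sumTo n (λ k → + (n C k) * A S 1 x k α β (γ ℕ.+ β ℕ.+ α) * A S l x (n ∸ k) α β 0)
  ∎
  where
    open ≡-Reasoning
    a b g X : ℤ
    a = + α
    b = + β
    g = + γ
    X = + x
    swap-last : ∀ (g b a : ℤ) → g + b + a ≡ g + a + b
    swap-last = solve-∀
    convolution-term : ∀ k → + (n C k) * A S 1 x k α β (γ ℕ.+ β ℕ.+ α) * A S l x (n ∸ k) α β 0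
                           ≡ + (n C k) * Adiff a b X 1 k (g + a + b) * Adiff a b X l (n ∸ k) (+ 0)
    convolution-term k = cong₂ (λ u v → + (n C k) * u * v)
      (trans (A≡Adiff S isS 1 x k α β (γ ℕ.+ β ℕ.+ α)) (cong (Adiff a b X 1 k) (swap-last g b a)))
      (A≡Adiff S isS l x (n ∸ k) α β 0)
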